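{- Let $d$ and $\eta$ be positive integers. Let $G$ be a graph with maximum degree at most $d$, and let $(T,(X_t:t\in V(T)))$ be a tree-decomposition of $G$ of adhesion at most $\eta$. Then there exists a tree-decomposition $(T,(X'_t:t\in V(T)))$ of $G$ (with the same tree $T$) such that \begin{enumerate} \item the adhesion of $(T,(X'_t))$ is at most the adhesion of $(T,(X_t))$; \item for every $t\in V(T)$, $X'_t\subseteq X_t$, and the torso at $t$ in $(T,(X'_t))$ is a subgraph of the torso at $t$ in $(T,(X_t))$; \item for every $t\in V(T)$ and $v\in X'_t$, there are at most $d+1$ neighbors $t'$ of $t$ in $T$ with $v\in X'_{t'}$; and \item for every $t\in V(T)$, the torso at $t$ in $(T,(X'_t))$ has maximum degree at most $\eta d+\eta-1$. \end{enumerate}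
   Context: Graphs are finite and may have loops and parallel edges; degree counts loops twice. A tree-decomposition of $G$ is a pair $(T,(X_t:t\in V(T)))$ with $T$ a tree and $X_t\subseteq V(G)$ such that $\bigcup_t X_t=V(G)$, every edge of $G$ has all its ends in some $X_t$, and for every vertex $v$ the set $\{t: v\in X_t\}$ induces a connected subtree of $T$. Its adhesion is $\max_{tt'\in E(T)}|X_t\cap X_{t'}|$. The torso at $t$ is the graph obtained from $G[X_t]$ by, for each neighbor $t'$ of $t$ in $T$, adding edges so that $X_t\cap X_{t'}$ becomes a clique. -}

module Defs where

open import Data.Nat using (ℕ; zero; suc; _+_; _*_; _∸_; _≤_; _⊔_)
open import Data.Bool using (Bool; true; false; _∧_; not; if_then_else_)
open import Data.Fin using (Fin; zero; suc; inject₁; fromℕ; _≟_)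
open import Data.Fin.Subset using (Subset; _∈_; _⊆_; _∩_; ∣_∣)
open import Data.Vec using (lookup)
open import Data.Product using (Σ; ∃; _×_; _,_)
open import Data.Empty using (⊥)
open import Data.Unit using (⊤)
open import Relation.Binary.PropositionalEquality using (_≡_)
open import Relation.Nullary.Decidable using (⌊_⌋)
open import Function.Definitions using (Injective)

ΣF : {n : ℕ} → (Fin n → ℕ) → ℕ
ΣF {zero}  f = 0
ΣF {suc n} f = f zero + ΣF (λ i → f (suc i))

maxF : {n : ℕ} → (Fin n → ℕ) → ℕ
maxF {zero}  f = 0
maxF {suc n} f = f zero ⊔ maxF (λ i → f (suc i))

anyF : {n : ℕ} → (Fin n → Bool) → Bool
anyF {zero}  f = false
anyF {suc n} f = if f zero then true else anyF (λ i → f (suc i))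

_∋ᵇ_ : {n : ℕ} → Subset n → Fin n → Bool
X ∋ᵇ v = lookup X v

-- Finite multigraphs (loops and parallel edges allowed) on vertex set Fin n,
-- given by their symmetric edge-multiplicity matrix: μ u v is the number of
-- edges with ends u and v (μ v v = number of loops at v).

record Graph (n : ℕ) : Set where
  field
    μ   : Fin n → Fin n → ℕ
    sym : ∀ u v → μ u v ≡ μ v u
open Graph public

-- degree: loops count twice
deg : {n : ℕ} → (Fin n → Fin n → ℕ) → Fin n → ℕ
deg m v = ΣF (λ u → m v u) + m v v

MaxDegreeAtMost : {n : ℕ} → Graph n → ℕ → Set
MaxDegreeAtMost G d = ∀ v → deg (μ G) v ≤ d

-- A graph whose vertex set is a subset V of Fin n (multiplicity 0 outside V).
record SubsetGraph (n : ℕ) : Set where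
  field
    verts : Subset n
    mult  : Fin n → Fin n → ℕ
open SubsetGraph public

IsSubgraph : {n : ℕ} → SubsetGraph n → SubsetGraph n → Set
IsSubgraph H H' = (verts H ⊆ verts H') × (∀ u v → mult H u v ≤ mult H' u v)

SGMaxDegreeAtMost : {n : ℕ} → SubsetGraph n → ℕ → Set
SGMaxDegreeAtMost H D = ∀ v → v ∈ verts H → deg (mult H) v ≤ D

data WalkIn {k : ℕ} (A : Fin k → Fin k → Bool) (P : Fin k → Set)
     : Fin k → Fin k → Set where
  here : ∀ {a} → P a → WalkIn A P a a
  step : ∀ {a b c} → P a → A a c ≡ true → WalkIn A P c b → WalkIn A P a b

-- no cycle: no injective closed walk c0 c1 ... c(l+2) c0 of length ≥ 3
Acyclic : {k : ℕ} → (Fin k → Fin k → Bool) → Set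
Acyclic {k} A = ∀ (l : ℕ) (c : Fin (suc (suc (suc l))) → Fin k)
  → Injective _≡_ _≡_ c
  → (∀ (i : Fin (suc (suc l))) → A (c (inject₁ i)) (c (suc i)) ≡ true)
  → A (c (fromℕ (suc (suc l)))) (c zero) ≡ true
  → ⊥

record Tree : Set where
  field
    k         : ℕ
    adj       : Fin k → Fin k → Bool
    adj-sym   : ∀ s t → adj s t ≡ adj t s
    irrefl    : ∀ t → adj t t ≡ false
    connected : ∀ s t → WalkIn adj (λ _ → ⊤) s t
    acyclic   : Acyclic adj
open Tree public

Node : Tree → Set
Node T = Fin (k T)

Bags : ℕ → Tree → Set
Bags n T = Node T → Subset n

record IsTreeDecomposition {n : ℕ} (G : Graph n) (T : Tree) (X : Bags n T) : Set where
  field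
    covers    : ∀ v → ∃ λ t → v ∈ X t
    edges     : ∀ u v → 1 ≤ μ G u v → ∃ λ t → (u ∈ X t) × (v ∈ X t)
    subtree   : ∀ v s t → v ∈ X s → v ∈ X t → WalkIn (adj T) (λ r → v ∈ X r) s t

-- adhesion = max over edges tt' of T of |X_t ∩ X_t'| (0 if T has no edges)
adhesion : {n : ℕ} (T : Tree) → Bags n T → ℕ
adhesion T X = maxF (λ s → maxF (λ t → if adj T s t then ∣ X s ∩ X t ∣ else 0))

sharedAdhesion : {n : ℕ} (T : Tree) → Bags n T → Node T → Fin n → Fin n → Bool
sharedAdhesion T X t u v =
  not ⌊ u ≟ v ⌋ ∧ anyF (λ t' → adj T t t' ∧ (X t ∋ᵇ u) ∧ (X t ∋ᵇ v) ∧ (X t' ∋ᵇ u) ∧ (X t' ∋ᵇ v))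

-- torso at t: G[X_t] plus edges making each X_t ∩ X_t' a clique
-- (an edge uv is added only where u,v are distinct and not already adjacent)
torso : {n : ℕ} → Graph n → (T : Tree) → Bags n T → Node T → SubsetGraph n
torso G T X t = record
  { verts = X t
  ; mult  = λ u v → if (X t ∋ᵇ u) ∧ (X t ∋ᵇ v)
                      then μ G u v ⊔ (if sharedAdhesion T X t u v then 1 else 0)
                      else 0
  }

neighboursContaining : {n : ℕ} (T : Tree) → Bags n T → Node T → Fin n → ℕ
neighboursContaining T X t v = ΣF (λ t' → if adj T t t' ∧ (X t' ∋ᵇ v) then 1 else 0)

module Submission where

-- Fix for every vertex v a bag containing it (its centre) and, for every edge vu, a bag
-- containing both ends, chosen symmetrically in u and v.  Keep v in X_t exactly when t lies
-- on the tree path from the centre of v to one of its edge bags.  The new bags are unions of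
-- paths out of a common node, hence still subtrees, and they shrink the old ones, so adhesion
-- and torsos can only shrink.  At a node t, a neighbour t' still containing v either lies past
-- t on the path towards the edge bag of some edge vu, or is reached from the centre of v
-- without passing t; since T is a tree, t' is determined by u (resp. by lying on the centre
-- side), giving at most deg v + 1 ≤ d + 1 such neighbours.  A torso edge at v is an edge of G
-- or lies in one of these adhesion sets, each adding at most η − 1 vertices besides v, so the
-- torso degree is at most d + (d + 1)(η − 1) = ηd + η − 1.

open import Defs hiding (sym)
open import Data.Nat using (ℕ; zero; suc; _+_; _*_; _∸_; _≤_; z≤n; s≤s; _≤?_)
open import Data.Nat.Properties
  using (≤-refl; ≤-reflexive; ≤-trans; +-mono-≤; +-monoʳ-≤; *-mono-≤; ∸-monoˡ-≤; +-suc; +-identityʳ;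
         m≤m+n; m≤n+m; m≤m⊔n; m≤n⊔m; ⊔-mono-≤; m⊔n≤m+n; ⊔-identityʳ; *-distribʳ-+; module ≤-Reasoning)
open import Data.Nat.Tactic.RingSolver using (solve-∀)
open import Data.Bool using (Bool; true; false; _∧_; not; if_then_else_)
open import Data.Fin using (Fin; zero; suc; inject₁; fromℕ; _≟_)
open import Data.Fin.Properties using (any?; suc-injective)
  renaming (_≤?_ to _≤ᶠ?_; ≤-antisym to ≤ᶠ-antisym; ≤-total to ≤ᶠ-total)
open import Data.Fin.Subset using (Subset; _∈_; _⊆_; _∩_; ∣_∣)
open import Data.Fin.Subset.Properties using (p⊆q⇒∣p∣≤∣q∣; x∈p∩q⁺; x∈p∩q⁻)
open import Data.Vec using (Vec; []; _∷_; lookup; tabulate)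
open import Data.Vec.Properties using (lookup∘tabulate; []=⇒lookup; lookup⇒[]=)
open import Data.Product using (Σ; ∃; _×_; _,_; proj₁; proj₂)
open import Data.Sum using (_⊎_; inj₁; inj₂; [_,_]′)
open import Data.Empty using (⊥; ⊥-elim)
open import Data.Unit using (⊤; tt)
open import Function using (_∘_)
open import Relation.Nullary using (¬_; Dec; yes; no)
open import Relation.Nullary.Decidable using (⌊_⌋; _⊎-dec_; _×-dec_)
open import Relation.Binary.PropositionalEquality
  using (_≡_; _≢_; refl; sym; trans; cong; cong₂; subst; module ≡-Reasoning)

module Walks {k : ℕ} (A : Fin k → Fin k → Bool) where

  infixr 5 _∷_ _++_
  infix 4 _∈ʷ_ _⊆ʷ_

  data Walk : Fin k → Fin k → Set where
    []  : ∀ {a} → Walk a a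
    _∷_ : ∀ {a b c} → A a c ≡ true → Walk c b → Walk a b

  _∈ʷ_ : ∀ {a b} → Fin k → Walk a b → Set
  x ∈ʷ [] {a} = x ≡ a
  x ∈ʷ _∷_ {a} _ w = x ≡ a ⊎ x ∈ʷ w

  _⊆ʷ_ : ∀ {a b c d} → Walk a b → Walk c d → Set
  w ⊆ʷ w' = ∀ x → x ∈ʷ w → x ∈ʷ w'

  Avoids : Fin k → ∀ {a b} → Walk a b → Set
  Avoids t w = ∀ x → x ∈ʷ w → x ≢ t

  _∈ʷ?_ : ∀ {a b} x (w : Walk a b) → Dec (x ∈ʷ w)
  x ∈ʷ? [] {a} = x ≟ a
  x ∈ʷ? _∷_ {a} _ w = (x ≟ a) ⊎-dec (x ∈ʷ? w)

  start∈ : ∀ {a b} (w : Walk a b) → a ∈ʷ w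
  start∈ []      = refl
  start∈ (_ ∷ _) = inj₁ refl

  end∈ : ∀ {a b} (w : Walk a b) → b ∈ʷ w
  end∈ []      = refl
  end∈ (_ ∷ w) = inj₂ (end∈ w)

  toWalkIn : ∀ {P : Fin k → Set} {a b} (w : Walk a b) → (∀ r → r ∈ʷ w → P r) → WalkIn A P a b
  toWalkIn []            P-w = here (P-w _ refl)
  toWalkIn (_∷_ {a} e w) P-w = step (P-w a (inj₁ refl)) e (toWalkIn w (λ r → P-w r ∘ inj₂))

  fromWalkIn : ∀ {P : Fin k → Set} {a b} → WalkIn A P a b → Σ (Walk a b) λ w → ∀ r → r ∈ʷ w → P r
  fromWalkIn (here p) = [] , λ { r refl → p }
  fromWalkIn (step p e w) with fromWalkIn w
  ... | w' , P-w' = e ∷ w' , λ { r (inj₁ refl) → p ; r (inj₂ q) → P-w' r q }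

  _++_ : ∀ {a b c} → Walk a b → Walk b c → Walk a c
  []      ++ w' = w'
  (e ∷ w) ++ w' = e ∷ (w ++ w')

  ∈-++⁻ : ∀ {a b c} (w : Walk a b) {w' : Walk b c} x → x ∈ʷ w ++ w' → x ∈ʷ w ⊎ x ∈ʷ w'
  ∈-++⁻ []      x p        = inj₂ p
  ∈-++⁻ (e ∷ w) x (inj₁ p) = inj₁ (inj₁ p)
  ∈-++⁻ (e ∷ w) x (inj₂ p) = [ inj₁ ∘ inj₂ , inj₂ ]′ (∈-++⁻ w x p)

  prefix : ∀ {a b y} (w : Walk a b) → y ∈ʷ w → Σ (Walk a y) λ p → p ⊆ʷ w
  prefix []      refl        = [] , λ x q → q
  prefix (e ∷ w) (inj₁ refl) = [] , λ x → inj₁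
  prefix (e ∷ w) (inj₂ q) with prefix w q
  ... | p , p⊆w = e ∷ p , λ { x (inj₁ r) → inj₁ r ; x (inj₂ r) → inj₂ (p⊆w x r) }

  Simple : ∀ {a b} → Walk a b → Set
  Simple []            = ⊤
  Simple (_∷_ {a} _ w) = ¬ (a ∈ʷ w) × Simple w

  simple-suffix : ∀ {a b y} (w : Walk a b) → y ∈ʷ w → Simple w
    → Σ (Walk y b) λ p → Simple p × p ⊆ʷ w
  simple-suffix []      refl        s       = [] , tt , λ x q → q
  simple-suffix (e ∷ w) (inj₁ refl) s       = e ∷ w , s , λ x q → q
  simple-suffix (e ∷ w) (inj₂ q)    (_ , s) with simple-suffix w q s
  ... | p , sp , p⊆w = p , sp , λ x → inj₂ ∘ p⊆w x

  simplify : ∀ {a b} (w : Walk a b) → Σ (Walk a b) λ p → Simple p × p ⊆ʷ w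
  simplify []            = [] , tt , λ x q → q
  simplify (_∷_ {a} e w) with simplify w
  ... | p , sp , p⊆w with a ∈ʷ? p
  ... | yes a∈p = let (r , sr , r⊆p) = simple-suffix p a∈p sp in r , sr , λ x → inj₂ ∘ p⊆w x ∘ r⊆p x
  ... | no  a∉p = e ∷ p , (a∉p , sp) , λ { x (inj₁ r) → inj₁ r ; x (inj₂ r) → inj₂ (p⊆w x r) }

  Before : Fin k → Fin k → ∀ {a b} → Walk a b → Set
  Before x y []            = ⊥
  Before x y (_∷_ {a} _ w) = (x ≡ a × y ∈ʷ w) ⊎ Before x y w

  Before? : ∀ {a b} x y (w : Walk a b) → Dec (Before x y w)
  Before? x y []            = no λ ()
  Before? x y (_∷_ {a} _ w) = ((x ≟ a) ×-dec (y ∈ʷ? w)) ⊎-dec Before? x y w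

  Before⇒∈ : ∀ {a b x y} (w : Walk a b) → Before x y w → x ∈ʷ w
  Before⇒∈ (e ∷ w) (inj₁ (p , _)) = inj₁ p
  Before⇒∈ (e ∷ w) (inj₂ q)       = inj₂ (Before⇒∈ w q)

  prefix-avoiding : ∀ {a b t y} (w : Walk a b) → y ∈ʷ w → ¬ Before t y w → t ≢ y
    → Σ (Walk a y) (Avoids t)
  prefix-avoiding []      refl        _  t≢y = [] , λ { x refl refl → t≢y refl }
  prefix-avoiding (e ∷ w) (inj₁ refl) _  t≢y = [] , λ { x refl refl → t≢y refl }
  prefix-avoiding {t = t} (_∷_ {a} e w) (inj₂ q) ¬t<y t≢y with t ≟ a
  ... | yes t≡a = ⊥-elim (¬t<y (inj₁ (t≡a , q)))
  ... | no  t≢a with prefix-avoiding w q (¬t<y ∘ inj₂) t≢y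
  ... | p , p-avoids = e ∷ p , λ { x (inj₁ refl) refl → t≢a refl ; x (inj₂ r) → p-avoids x r }

  length : ∀ {a b} → Walk a b → ℕ
  length []      = zero
  length (_ ∷ w) = suc (length w)

  nodes : ∀ {a b} (w : Walk a b) → Vec (Fin k) (suc (length w))
  nodes ([] {a})      = a ∷ []
  nodes (_∷_ {a} _ w) = a ∷ nodes w

  nodes-adjacent : ∀ {a b} (w : Walk a b) (j : Fin (length w))
    → A (lookup (nodes w) (inject₁ j)) (lookup (nodes w) (suc j)) ≡ true
  nodes-adjacent (e ∷ [])     zero    = e
  nodes-adjacent (e ∷ _ ∷ _)  zero    = e
  nodes-adjacent (_ ∷ w)      (suc j) = nodes-adjacent w j

  nodes-last : ∀ {a b} (w : Walk a b) → lookup (nodes w) (fromℕ (length w)) ≡ b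
  nodes-last []      = refl
  nodes-last (_ ∷ w) = nodes-last w

  nodes-∈ : ∀ {a b} (w : Walk a b) i → lookup (nodes w) i ∈ʷ w
  nodes-∈ []      zero    = refl
  nodes-∈ (_ ∷ w) zero    = inj₁ refl
  nodes-∈ (_ ∷ w) (suc i) = inj₂ (nodes-∈ w i)

  nodes-injective : ∀ {a b} (w : Walk a b) → Simple w
    → ∀ i j → lookup (nodes w) i ≡ lookup (nodes w) j → i ≡ j
  nodes-injective []      _         zero    zero    _  = refl
  nodes-injective (_ ∷ w) _         zero    zero    _  = refl
  nodes-injective (_ ∷ w) (a∉w , _) zero    (suc j) eq = ⊥-elim (a∉w (subst (_∈ʷ w) (sym eq) (nodes-∈ w j)))
  nodes-injective (_ ∷ w) (a∉w , _) (suc i) zero    eq = ⊥-elim (a∉w (subst (_∈ʷ w) eq (nodes-∈ w i)))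
  nodes-injective (_ ∷ w) (_ , s)   (suc i) (suc j) eq = cong suc (nodes-injective w s i j eq)

  module _ (A-sym : ∀ s t → A s t ≡ A t s) where

    reverse : ∀ {a b} → Walk a b → Walk b a
    reverse []            = []
    reverse (_∷_ {a} e w) = reverse w ++ (trans (A-sym _ a) e ∷ [])

    ∈-reverse⁻ : ∀ {a b} (w : Walk a b) x → x ∈ʷ reverse w → x ∈ʷ w
    ∈-reverse⁻ []      x p = p
    ∈-reverse⁻ (e ∷ w) x p with ∈-++⁻ (reverse w) x p
    ... | inj₁ q        = inj₂ (∈-reverse⁻ w x q)
    ... | inj₂ (inj₁ refl) = inj₂ (start∈ w)
    ... | inj₂ (inj₂ q)    = inj₁ q

    bridge : ∀ {a y z} → Walk a y → Walk a z → Walk y z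
    bridge p q = reverse p ++ q

    ∈-bridge⁻ : ∀ {a y z} (p : Walk a y) (q : Walk a z) x → x ∈ʷ bridge p q → x ∈ʷ p ⊎ x ∈ʷ q
    ∈-bridge⁻ p q x r = [ inj₁ ∘ ∈-reverse⁻ p x , inj₂ ]′ (∈-++⁻ (reverse p) x r)

    within : ∀ {a b y z} (w : Walk a b) → y ∈ʷ w → z ∈ʷ w → Σ (Walk y z) λ p → p ⊆ʷ w
    within w y∈w z∈w with prefix w y∈w | prefix w z∈w
    ... | p , p⊆w | q , q⊆w = bridge p q , λ x r → [ p⊆w x , q⊆w x ]′ (∈-bridge⁻ p q x r)

    -- A simple walk visits t only once, so what follows t avoids it.
    after-avoiding : ∀ {a b t y z} (w : Walk a b) → Simple w → Before t y w → Before t z w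
      → Σ (Walk y z) (Avoids t)
    after-avoiding (e ∷ w) (t∉w , _) (inj₁ (refl , y∈w)) (inj₁ (_ , z∈w)) with within w y∈w z∈w
    ... | p , p⊆w = p , λ { x r refl → t∉w (p⊆w x r) }
    after-avoiding (e ∷ w) (t∉w , _) (inj₁ (refl , _)) (inj₂ t<z) = ⊥-elim (t∉w (Before⇒∈ w t<z))
    after-avoiding (e ∷ w) (t∉w , _) (inj₂ t<y) (inj₁ (refl , _)) = ⊥-elim (t∉w (Before⇒∈ w t<y))
    after-avoiding (e ∷ w) (_ , s)   (inj₂ t<y) (inj₂ t<z)         = after-avoiding w s t<y t<z

module _ (T : Tree) where
  open Walks (adj T)

  adj⇒≢ : ∀ {t t'} → adj T t t' ≡ true → t ≢ t'
  adj⇒≢ {t} tt' refl with trans (sym tt') (irrefl T t)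
  ... | ()

  -- Otherwise t, a, (simple walk to b), t would be a cycle.
  neighbours-joined-avoiding-≡ : ∀ {t a b} → adj T t a ≡ true → adj T t b ≡ true
    → (w : Walk a b) → Avoids t w → a ≡ b
  neighbours-joined-avoiding-≡ {t} {a} {b} ta tb w w-avoids with a ≟ b
  ... | yes a≡b = a≡b
  ... | no  a≢b with simplify w
  ... | [] , _ , _ = ⊥-elim (a≢b refl)
  ... | e ∷ p' , sp , p⊆w =
    ⊥-elim (acyclic T (length p') cycle cycle-injective cycle-adjacent cycle-closes)
    where
      p : Walk a b
      p = e ∷ p'
      cycle : Fin (suc (suc (suc (length p')))) → Node T
      cycle = lookup (t ∷ nodes p)
      p-avoids : Avoids t p
      p-avoids x = w-avoids x ∘ p⊆w x
      cycle-injective : ∀ {i j} → cycle i ≡ cycle j → i ≡ j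
      cycle-injective {zero}  {zero}  _  = refl
      cycle-injective {zero}  {suc j} eq = ⊥-elim (p-avoids _ (nodes-∈ p j) (sym eq))
      cycle-injective {suc i} {zero}  eq = ⊥-elim (p-avoids _ (nodes-∈ p i) eq)
      cycle-injective {suc i} {suc j} eq = cong suc (nodes-injective p sp i j eq)
      cycle-adjacent : ∀ (i : Fin (suc (suc (length p'))))
        → adj T (cycle (inject₁ i)) (cycle (suc i)) ≡ true
      cycle-adjacent zero    = ta
      cycle-adjacent (suc j) = nodes-adjacent p j
      cycle-closes : adj T (cycle (fromℕ (suc (suc (length p'))))) (cycle zero) ≡ true
      cycle-closes = subst (λ z → adj T z t ≡ true) (sym (nodes-last p)) (trans (adj-sym T b t) tb)

χ : Bool → ℕ
χ b = if b then 1 else 0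

count : ∀ {m} → (Fin m → Bool) → ℕ
count P = ΣF (λ i → χ (P i))

∧⁻ : ∀ a {b} → a ∧ b ≡ true → a ≡ true × b ≡ true
∧⁻ true p = refl , p

∧-intro : ∀ {a b} → a ≡ true → b ≡ true → a ∧ b ≡ true
∧-intro refl refl = refl

χ-mono : ∀ {a b} → (a ≡ true → b ≡ true) → χ a ≤ χ b
χ-mono {false} _   = z≤n
χ-mono {true}  a⇒b rewrite a⇒b refl = ≤-refl

χ-false : ∀ {a} → ¬ (a ≡ true) → χ a ≡ 0
χ-false {false} _ = refl
χ-false {true}  ¬a = ⊥-elim (¬a refl)

ΣF-cong : ∀ {m} {f g : Fin m → ℕ} → (∀ i → f i ≡ g i) → ΣF f ≡ ΣF g
ΣF-cong {zero}  _ = refl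
ΣF-cong {suc m} f≡g = cong₂ _+_ (f≡g zero) (ΣF-cong (f≡g ∘ suc))

ΣF-mono : ∀ {m} {f g : Fin m → ℕ} → (∀ i → f i ≤ g i) → ΣF f ≤ ΣF g
ΣF-mono {zero}  _ = z≤n
ΣF-mono {suc m} f≤g = +-mono-≤ (f≤g zero) (ΣF-mono (f≤g ∘ suc))

ΣF-zero : ∀ {m} → ΣF {m} (λ _ → 0) ≡ 0
ΣF-zero {zero}  = refl
ΣF-zero {suc m} = ΣF-zero {m}

ΣF-term≤ : ∀ {m} (f : Fin m → ℕ) i → f i ≤ ΣF f
ΣF-term≤ f zero    = m≤m+n _ _
ΣF-term≤ f (suc i) = ≤-trans (ΣF-term≤ (f ∘ suc) i) (m≤n+m _ (f zero))

ΣF-+ : ∀ {m} (f g : Fin m → ℕ) → ΣF (λ i → f i + g i) ≡ ΣF f + ΣF g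
ΣF-+ {zero}  f g = refl
ΣF-+ {suc m} f g rewrite ΣF-+ (f ∘ suc) (g ∘ suc) = interchange (f zero) (g zero) _ _
  where
    interchange : ∀ a b c d → (a + b) + (c + d) ≡ (a + c) + (b + d)
    interchange = solve-∀

ΣF-comm : ∀ {m p} (h : Fin m → Fin p → ℕ) → ΣF (λ i → ΣF (h i)) ≡ ΣF (λ j → ΣF (λ i → h i j))
ΣF-comm {zero}  {p} h = sym (ΣF-zero {p})
ΣF-comm {suc m} h rewrite ΣF-comm (h ∘ suc) = sym (ΣF-+ (h zero) (λ j → ΣF (λ i → h (suc i) j)))

ΣF-*ʳ : ∀ {m} (f : Fin m → ℕ) c → ΣF (λ i → f i * c) ≡ ΣF f * c
ΣF-*ʳ {zero}  f c = refl
ΣF-*ʳ {suc m} f c rewrite ΣF-*ʳ (f ∘ suc) c = sym (*-distribʳ-+ c (f zero) _)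

maxF-mono : ∀ {m} {f g : Fin m → ℕ} → (∀ i → f i ≤ g i) → maxF f ≤ maxF g
maxF-mono {zero}  _ = z≤n
maxF-mono {suc m} f≤g = ⊔-mono-≤ (f≤g zero) (maxF-mono (f≤g ∘ suc))

maxF-term≤ : ∀ {m} (f : Fin m → ℕ) i → f i ≤ maxF f
maxF-term≤ f zero    = m≤m⊔n _ _
maxF-term≤ f (suc i) = ≤-trans (maxF-term≤ (f ∘ suc) i) (m≤n⊔m (f zero) _)

anyF⇒∃ : ∀ {m} (f : Fin m → Bool) → anyF f ≡ true → ∃ λ i → f i ≡ true
anyF⇒∃ {suc m} f p with f zero in f0
... | true  = zero , f0
... | false = let (i , q) = anyF⇒∃ (f ∘ suc) p in suc i , q

∃⇒anyF : ∀ {m} (f : Fin m → Bool) i → f i ≡ true → anyF f ≡ true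
∃⇒anyF f zero    p rewrite p = refl
∃⇒anyF f (suc i) p with f zero
... | true  = refl
... | false = ∃⇒anyF (f ∘ suc) i p

count-mono : ∀ {m} {P Q : Fin m → Bool} → (∀ i → P i ≡ true → Q i ≡ true) → count P ≤ count Q
count-mono P⇒Q = ΣF-mono (λ i → χ-mono (P⇒Q i))

χ-∧-anyF≤ΣF : ∀ {m} b (f : Fin m → Bool) → χ (b ∧ anyF f) ≤ ΣF (λ i → χ (b ∧ f i))
χ-∧-anyF≤ΣF false f = z≤n
χ-∧-anyF≤ΣF true  f with anyF f in any-f
... | false = z≤n
... | true  = let (i , fi) = anyF⇒∃ f any-f in
              ≤-trans (≤-reflexive (cong χ (sym fi))) (ΣF-term≤ (χ ∘ f) i)

does-suc-≟ : ∀ {m} (i j : Fin m) → ⌊ suc i ≟ suc j ⌋ ≡ ⌊ i ≟ j ⌋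
does-suc-≟ i j with i ≟ j
... | yes _ = refl
... | no  _ = refl

count-remove : ∀ {m} (Q : Fin m → Bool) j → Q j ≡ true
  → count Q ≡ suc (count (λ i → not ⌊ j ≟ i ⌋ ∧ Q i))
count-remove Q zero Qj rewrite Qj = refl
count-remove {suc m} Q (suc j) Qj = begin
    χ (Q zero) + count (Q ∘ suc)
  ≡⟨ cong (χ (Q zero) +_) (count-remove (Q ∘ suc) j Qj) ⟩
    χ (Q zero) + suc (count (λ i → not ⌊ j ≟ i ⌋ ∧ Q (suc i)))
  ≡⟨ +-suc (χ (Q zero)) _ ⟩
    suc (χ (Q zero) + count (λ i → not ⌊ j ≟ i ⌋ ∧ Q (suc i)))
  ≡⟨ cong (λ c → suc (χ (Q zero) + c))
          (ΣF-cong (λ i → cong (λ b → χ (not b ∧ Q (suc i))) (sym (does-suc-≟ j i)))) ⟩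
    suc (χ (Q zero) + count (λ i → not ⌊ suc j ≟ suc i ⌋ ∧ Q (suc i)))
  ∎
  where open ≡-Reasoning

count-≤-injection : ∀ {m p} (P : Fin m → Bool) (Q : Fin p → Bool)
  (g : ∀ i → P i ≡ true → Fin p) → (∀ i Pi → Q (g i Pi) ≡ true)
  → (∀ i j Pi Pj → g i Pi ≡ g j Pj → i ≡ j) → count P ≤ count Q
count-≤-injection {zero} P Q g g-Q g-inj = z≤n
count-≤-injection {suc m} {p} P Q g g-Q g-inj with P zero in P0
... | false = count-≤-injection (P ∘ suc) Q (g ∘ suc) (g-Q ∘ suc) g∘suc-inj
  where
    g∘suc-inj : ∀ i j Pi Pj → g (suc i) Pi ≡ g (suc j) Pj → i ≡ j
    g∘suc-inj i j Pi Pj = suc-injective ∘ g-inj (suc i) (suc j) Pi Pj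
... | true  = subst (suc (count (P ∘ suc)) ≤_) (sym (count-remove Q j₀ (g-Q zero P0)))
                (s≤s (count-≤-injection (P ∘ suc) Q' (g ∘ suc) g-Q' g∘suc-inj))
  where
    g∘suc-inj : ∀ i j Pi Pj → g (suc i) Pi ≡ g (suc j) Pj → i ≡ j
    g∘suc-inj i j Pi Pj = suc-injective ∘ g-inj (suc i) (suc j) Pi Pj
    j₀ : Fin p
    j₀ = g zero P0
    Q' : Fin p → Bool
    Q' j = not ⌊ j₀ ≟ j ⌋ ∧ Q j
    g-Q' : ∀ i Pi → Q' (g (suc i) Pi) ≡ true
    g-Q' i Pi with j₀ ≟ g (suc i) Pi
    ... | yes j₀≡gi = ⊥-elim (0≢1+n (g-inj zero (suc i) P0 Pi j₀≡gi))
      where 0≢1+n : ∀ {m} {a : Fin m} → Fin.zero ≢ suc a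
            0≢1+n ()
    ... | no  _     = g-Q (suc i) Pi

∋ᵇ⇒∈ : ∀ {m} {p : Subset m} {x} → (p ∋ᵇ x) ≡ true → x ∈ p
∋ᵇ⇒∈ {p = p} {x} = lookup⇒[]= x p

∈⇒∋ᵇ : ∀ {m} {p : Subset m} {x} → x ∈ p → (p ∋ᵇ x) ≡ true
∈⇒∋ᵇ = []=⇒lookup

∣∣≡count : ∀ {m} (p : Subset m) → ∣ p ∣ ≡ count (p ∋ᵇ_)
∣∣≡count []          = refl
∣∣≡count (true ∷ p)  = cong suc (∣∣≡count p)
∣∣≡count (false ∷ p) = ∣∣≡count p

⌊⌋≡true⁻ : ∀ {A : Set} (a? : Dec A) → ⌊ a? ⌋ ≡ true → A
⌊⌋≡true⁻ (yes a) _ = a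

⌊⌋≡true⁺ : ∀ {A : Set} (a? : Dec A) → ¬ ¬ A → ⌊ a? ⌋ ≡ true
⌊⌋≡true⁺ (yes _) _   = refl
⌊⌋≡true⁺ (no ¬a) ¬¬a = ⊥-elim (¬¬a ¬a)

∩-mono : ∀ {m} {p p' q q' : Subset m} → p ⊆ p' → q ⊆ q' → p ∩ q ⊆ p' ∩ q'
∩-mono {p = p} {q = q} p⊆p' q⊆q' x∈p∩q with x∈p∩q⁻ p q x∈p∩q
... | x∈p , x∈q = x∈p∩q⁺ (p⊆p' x∈p , q⊆q' x∈q)

module _ {n : ℕ} (T : Tree) where

  adhesion-mono : {X Y : Bags n T} → (∀ t → Y t ⊆ X t) → adhesion T Y ≤ adhesion T X
  adhesion-mono {X} {Y} Y⊆X = maxF-mono λ s → maxF-mono λ t → bag-mono s t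
    where
      bag-mono : ∀ s t → (if adj T s t then ∣ Y s ∩ Y t ∣ else 0)
                       ≤ (if adj T s t then ∣ X s ∩ X t ∣ else 0)
      bag-mono s t with adj T s t
      ... | true  = p⊆q⇒∣p∣≤∣q∣ (∩-mono (Y⊆X s) (Y⊆X t))
      ... | false = z≤n

  ∣∩∣≤adhesion : (X : Bags n T) {s t : Node T} → adj T s t ≡ true → ∣ X s ∩ X t ∣ ≤ adhesion T X
  ∣∩∣≤adhesion X {s} {t} st = begin
      ∣ X s ∩ X t ∣           ≡⟨ cong (λ b → if b then ∣ X s ∩ X t ∣ else 0) st ⟨
      edgeSize s t           ≤⟨ maxF-term≤ (edgeSize s) t ⟩
      maxF (edgeSize s)      ≤⟨ maxF-term≤ (maxF ∘ edgeSize) s ⟩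
      adhesion T X           ∎
    where
      open ≤-Reasoning
      edgeSize : Node T → Node T → ℕ
      edgeSize s' t' = if adj T s' t' then ∣ X s' ∩ X t' ∣ else 0

  torso-mono : (G : Graph n) {X Y : Bags n T} → (∀ t → Y t ⊆ X t)
    → ∀ t → IsSubgraph (torso G T Y t) (torso G T X t)
  torso-mono G {X} {Y} Y⊆X t = Y⊆X t , λ u v → if-mono (∧-mono (∋-mono t) (∋-mono t))
                                                 (⊔-mono-≤ (≤-refl {μ G u v}) (χ-mono (shared-mono u v)))
    where
      ∋-mono : ∀ t {u} → (Y t ∋ᵇ u) ≡ true → (X t ∋ᵇ u) ≡ true
      ∋-mono t = ∈⇒∋ᵇ ∘ Y⊆X t ∘ ∋ᵇ⇒∈
      ∧-mono : ∀ {a b a' b'} → (a' ≡ true → a ≡ true) → (b' ≡ true → b ≡ true)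
        → a' ∧ b' ≡ true → a ∧ b ≡ true
      ∧-mono {a' = a'} f g p = let (pa , pb) = ∧⁻ a' p in ∧-intro (f pa) (g pb)
      shared-mono : ∀ u v → sharedAdhesion T Y t u v ≡ true → sharedAdhesion T X t u v ≡ true
      shared-mono u v = ∧-mono {a = not ⌊ u ≟ v ⌋} (λ p → p) λ p →
        let (t' , q) = anyF⇒∃ _ p in
        ∃⇒anyF _ t' (∧-mono {a = adj T t t'} (λ p → p)
          (∧-mono (∋-mono t) (∧-mono (∋-mono t) (∧-mono (∋-mono t') (∋-mono t')))) q)
      if-mono : ∀ {a a' : Bool} {x x' : ℕ} → (a' ≡ true → a ≡ true) → x' ≤ x
        → (if a' then x' else 0) ≤ (if a then x else 0)
      if-mono {a' = false} _   _    = z≤n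
      if-mono {a' = true}  a'⇒a x'≤x rewrite a'⇒a refl = x'≤x

  others-in-adhesion≤ : (Y : Bags n T) {t t' : Node T} {v : Fin n} → adj T t t' ≡ true → v ∈ Y t → v ∈ Y t'
    → count (λ u → not ⌊ v ≟ u ⌋ ∧ ((Y t ∩ Y t') ∋ᵇ u)) ≤ adhesion T Y ∸ 1
  others-in-adhesion≤ Y {t} {t'} {v} tt' v∈Yt v∈Yt' = ∸-monoˡ-≤ 1 (begin
      suc (count (λ u → not ⌊ v ≟ u ⌋ ∧ ((Y t ∩ Y t') ∋ᵇ u)))
        ≡⟨ count-remove _ v (∈⇒∋ᵇ (x∈p∩q⁺ (v∈Yt , v∈Yt'))) ⟨
      count ((Y t ∩ Y t') ∋ᵇ_)                               ≡⟨ ∣∣≡count (Y t ∩ Y t') ⟨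
      ∣ Y t ∩ Y t' ∣                                          ≤⟨ ∣∩∣≤adhesion Y tt' ⟩
      adhesion T Y                                            ∎)
    where open ≤-Reasoning

  sharedVia : Bags n T → Node T → Fin n → Fin n → Node T → Bool
  sharedVia Y t v u t' = adj T t t' ∧ (Y t ∋ᵇ v) ∧ (Y t ∋ᵇ u) ∧ (Y t' ∋ᵇ v) ∧ (Y t' ∋ᵇ u)

  sharedVia⇒ : (Y : Bags n T) {t t' : Node T} {v u : Fin n} → sharedVia Y t v u t' ≡ true
    → (adj T t t' ∧ (Y t' ∋ᵇ v)) ≡ true × ((Y t ∩ Y t') ∋ᵇ u) ≡ true
  sharedVia⇒ Y {t} {t'} {v} {u} h =
    let (tt' , h₁)       = ∧⁻ (adj T t t') h
        (_ , h₂)         = ∧⁻ (Y t ∋ᵇ v) h₁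
        (u∈Yt , h₃)      = ∧⁻ (Y t ∋ᵇ u) h₂
        (v∈Yt' , u∈Yt') = ∧⁻ (Y t' ∋ᵇ v) h₃
    in ∧-intro tt' v∈Yt' ,
       ∈⇒∋ᵇ (x∈p∩q⁺ (∋ᵇ⇒∈ {p = Y t} {u} u∈Yt , ∋ᵇ⇒∈ {p = Y t'} {u} u∈Yt'))

  sharedVia-count≤ : (Y : Bags n T) {t : Node T} {v : Fin n} → v ∈ Y t → ∀ t'
    → count (λ u → not ⌊ v ≟ u ⌋ ∧ sharedVia Y t v u t')
      ≤ χ (adj T t t' ∧ (Y t' ∋ᵇ v)) * (adhesion T Y ∸ 1)
  sharedVia-count≤ Y {t} {v} v∈Yt t' with adj T t t' ∧ (Y t' ∋ᵇ v) in tt'∧v∈Yt'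
  ... | false = ≤-trans (ΣF-mono (λ u → ≤-reflexive (χ-false (not-shared u)))) (≤-reflexive (ΣF-zero {n}))
    where
      false≢true : false ≢ true
      false≢true ()
      not-shared : ∀ u → ¬ ((not ⌊ v ≟ u ⌋ ∧ sharedVia Y t v u t') ≡ true)
      not-shared u h =
        false≢true (trans (sym tt'∧v∈Yt') (proj₁ (sharedVia⇒ Y (proj₂ (∧⁻ (not ⌊ v ≟ u ⌋) h)))))
  ... | true = begin
      count (λ u → not ⌊ v ≟ u ⌋ ∧ sharedVia Y t v u t')
        ≤⟨ count-mono in-adhesion ⟩
      count (λ u → not ⌊ v ≟ u ⌋ ∧ ((Y t ∩ Y t') ∋ᵇ u))
        ≤⟨ others-in-adhesion≤ Y tt' v∈Yt (∋ᵇ⇒∈ {p = Y t'} {v} v∈Yt') ⟩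
      adhesion T Y ∸ 1                                     ≡⟨ +-identityʳ _ ⟨
      adhesion T Y ∸ 1 + 0                                 ∎
    where
      open ≤-Reasoning
      tt' : adj T t t' ≡ true
      tt' = proj₁ (∧⁻ (adj T t t') tt'∧v∈Yt')
      v∈Yt' : (Y t' ∋ᵇ v) ≡ true
      v∈Yt' = proj₂ (∧⁻ (adj T t t') tt'∧v∈Yt')
      in-adhesion : ∀ u → (not ⌊ v ≟ u ⌋ ∧ sharedVia Y t v u t') ≡ true
        → (not ⌊ v ≟ u ⌋ ∧ ((Y t ∩ Y t') ∋ᵇ u)) ≡ true
      in-adhesion u h = let (v≢u , h′) = ∧⁻ (not ⌊ v ≟ u ⌋) h
                        in ∧-intro v≢u (proj₂ (sharedVia⇒ Y h′))

  shared-count≤ : (Y : Bags n T) {t : Node T} {v : Fin n} → v ∈ Y t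
    → count (sharedAdhesion T Y t v) ≤ neighboursContaining T Y t v * (adhesion T Y ∸ 1)
  shared-count≤ Y {t} {v} v∈Yt = begin
      count (sharedAdhesion T Y t v)
        ≤⟨ ΣF-mono (λ u → χ-∧-anyF≤ΣF (not ⌊ v ≟ u ⌋) (shared u)) ⟩
      ΣF (λ u → ΣF (λ t' → χ (not ⌊ v ≟ u ⌋ ∧ shared u t')))
        ≡⟨ ΣF-comm (λ u t' → χ (not ⌊ v ≟ u ⌋ ∧ shared u t')) ⟩
      ΣF (λ t' → count (λ u → not ⌊ v ≟ u ⌋ ∧ shared u t'))
        ≤⟨ ΣF-mono (sharedVia-count≤ Y v∈Yt) ⟩
      ΣF (λ t' → χ (adj T t t' ∧ (Y t' ∋ᵇ v)) * (adhesion T Y ∸ 1))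
        ≡⟨ ΣF-*ʳ (λ t' → χ (adj T t t' ∧ (Y t' ∋ᵇ v))) _ ⟩
      neighboursContaining T Y t v * (adhesion T Y ∸ 1)
        ∎
    where
      open ≤-Reasoning
      shared : Fin n → Node T → Bool
      shared = sharedVia Y t v

  torso-mult≤ : (G : Graph n) (Y : Bags n T) (t : Node T) (u w : Fin n)
    → mult (torso G T Y t) u w ≤ μ G u w + χ (sharedAdhesion T Y t u w)
  torso-mult≤ G Y t u w with (Y t ∋ᵇ u) ∧ (Y t ∋ᵇ w)
  ... | true  = m⊔n≤m+n (μ G u w) (χ (sharedAdhesion T Y t u w))
  ... | false = z≤n

  torso-loops≤ : (G : Graph n) (Y : Bags n T) (t : Node T) (v : Fin n) → mult (torso G T Y t) v v ≤ μ G v v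
  torso-loops≤ G Y t v with v ≟ v
  ... | no v≢v = ⊥-elim (v≢v refl)
  ... | yes _ with (Y t ∋ᵇ v) ∧ (Y t ∋ᵇ v)
  ... | true  = ≤-reflexive (⊔-identityʳ (μ G v v))
  ... | false = z≤n

  -- Every torso edge at v is an edge of G or lies in an adhesion set X_t ∩ X_t' containing v.
  torso-degree≤ : (G : Graph n) (Y : Bags n T) (t : Node T) {v : Fin n} → v ∈ Y t
    → deg (mult (torso G T Y t)) v ≤ deg (μ G) v + neighboursContaining T Y t v * (adhesion T Y ∸ 1)
  torso-degree≤ G Y t {v} v∈Yt = begin
      ΣF (mult (torso G T Y t) v) + mult (torso G T Y t) v v
        ≤⟨ +-mono-≤ (ΣF-mono (torso-mult≤ G Y t v)) (torso-loops≤ G Y t v) ⟩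
      ΣF (λ u → μ G v u + χ (sharedAdhesion T Y t v u)) + μ G v v
        ≡⟨ cong (_+ μ G v v) (ΣF-+ (μ G v) (χ ∘ sharedAdhesion T Y t v)) ⟩
      ΣF (μ G v) + count (sharedAdhesion T Y t v) + μ G v v
        ≡⟨ +-swapʳ (ΣF (μ G v)) _ _ ⟩
      deg (μ G) v + count (sharedAdhesion T Y t v)
        ≤⟨ +-monoʳ-≤ (deg (μ G) v) (shared-count≤ Y v∈Yt) ⟩
      deg (μ G) v + neighboursContaining T Y t v * (adhesion T Y ∸ 1) ∎
    where
      open ≤-Reasoning
      +-swapʳ : ∀ a b c → a + b + c ≡ a + c + b
      +-swapʳ = solve-∀

module Pruning {n : ℕ} {G : Graph n} {T : Tree} {X : Bags n T} (td : IsTreeDecomposition G T X) where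
  open Walks (adj T)
  open IsTreeDecomposition td

  centre : Fin n → Node T
  centre v = proj₁ (covers v)

  centre-∈ : ∀ v → v ∈ X (centre v)
  centre-∈ v = proj₂ (covers v)

  someEdgeBag : Fin n → Fin n → Node T
  someEdgeBag u v with 1 ≤? μ G u v
  ... | yes uv = proj₁ (edges u v uv)
  ... | no  _  = centre u

  someEdgeBag-∋ : ∀ u v → 1 ≤ μ G u v → u ∈ X (someEdgeBag u v) × v ∈ X (someEdgeBag u v)
  someEdgeBag-∋ u v uv with 1 ≤? μ G u v
  ... | yes uv′ = proj₂ (edges u v uv′)
  ... | no  ¬uv = ⊥-elim (¬uv uv)

  edgeBag : Fin n → Fin n → Node T
  edgeBag u v with u ≤ᶠ? v
  ... | yes _ = someEdgeBag u v
  ... | no  _ = someEdgeBag v u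

  μ-sym-≥1 : ∀ {u v} → 1 ≤ μ G u v → 1 ≤ μ G v u
  μ-sym-≥1 {u} {v} = subst (1 ≤_) (Graph.sym G u v)

  edgeBag-∋ : ∀ u v → 1 ≤ μ G u v → u ∈ X (edgeBag u v) × v ∈ X (edgeBag u v)
  edgeBag-∋ u v uv with u ≤ᶠ? v
  ... | yes _ = someEdgeBag-∋ u v uv
  ... | no  _ = let (v∈ , u∈) = someEdgeBag-∋ v u (μ-sym-≥1 uv) in u∈ , v∈

  edgeBag-sym : ∀ u v → edgeBag u v ≡ edgeBag v u
  edgeBag-sym u v with u ≤ᶠ? v | v ≤ᶠ? u
  ... | yes u≤v | yes v≤u rewrite ≤ᶠ-antisym u≤v v≤u = refl
  ... | yes _   | no  _   = refl
  ... | no  _   | yes _   = refl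
  ... | no  u≰v | no  v≰u = ⊥-elim ([ u≰v , v≰u ]′ (≤ᶠ-total u v))

  record Route (v u : Fin n) : Set where
    field
      end      : Node T
      path     : Walk (centre v) end
      simple   : Simple path
      inside   : ∀ r → r ∈ʷ path → v ∈ X r
      end-edge : 1 ≤ μ G v u → end ≡ edgeBag v u
      trivial  : ¬ (1 ≤ μ G v u) → ∀ x y → ¬ Before x y path

  route : ∀ v u → Route v u
  route v u with 1 ≤? μ G v u
  ... | yes vu = let (w , w⊆Xv) = fromWalkIn (subtree v _ _ (centre-∈ v) (proj₁ (edgeBag-∋ v u vu)))
                     (p , sp , p⊆w) = simplify w
                 in record { end = edgeBag v u ; path = p ; simple = sp
                           ; inside = λ r → w⊆Xv r ∘ p⊆w r
                           ; end-edge = λ _ → refl ; trivial = λ ¬vu → ⊥-elim (¬vu vu) }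
  ... | no ¬vu = record { end = centre v ; path = [] ; simple = tt
                        ; inside = λ { r refl → centre-∈ v }
                        ; end-edge = λ vu → ⊥-elim (¬vu vu) ; trivial = λ _ x y () }

  path : ∀ v u → Walk (centre v) (Route.end (route v u))
  path v u = Route.path (route v u)

  X' : Bags n T
  X' t = tabulate (λ v → anyF (λ u → ⌊ t ∈ʷ? path v u ⌋))

  ∈X'⁻ : ∀ {t v} → v ∈ X' t → ∃ λ u → t ∈ʷ path v u
  ∈X'⁻ {t} {v} v∈X't with anyF⇒∃ _ (trans (sym (lookup∘tabulate _ v)) (∈⇒∋ᵇ v∈X't))
  ... | u , t∈path = u , ⌊⌋≡true⁻ (t ∈ʷ? path v u) t∈path

  ∈X'⁺ : ∀ {t v} u → t ∈ʷ path v u → v ∈ X' t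
  ∈X'⁺ {t} {v} u t∈path =
    ∋ᵇ⇒∈ (trans (lookup∘tabulate _ v)
                (∃⇒anyF _ u (⌊⌋≡true⁺ (t ∈ʷ? path v u) (λ t∉path → t∉path t∈path))))

  X'⊆X : ∀ t → X' t ⊆ X t
  X'⊆X t {v} v∈X't = let (u , t∈path) = ∈X'⁻ v∈X't in Route.inside (route v u) t t∈path

  X'-decomposition : IsTreeDecomposition G T X'
  X'-decomposition = record
    { covers  = λ v → centre v , ∈X'⁺ v (start∈ (path v v))
    ; edges   = λ u v uv → edgeBag u v , ∈X'-edgeBag uv ,
                  subst (λ b → v ∈ X' b) (edgeBag-sym v u) (∈X'-edgeBag (μ-sym-≥1 uv))
    ; subtree = X'-subtree }
    where
      ∈X'-edgeBag : ∀ {v u} → 1 ≤ μ G v u → v ∈ X' (edgeBag v u)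
      ∈X'-edgeBag {v} {u} vu =
        subst (λ b → v ∈ X' b) (Route.end-edge (route v u) vu) (∈X'⁺ u (end∈ (path v u)))

      X'-subtree : ∀ v s t → v ∈ X' s → v ∈ X' t → WalkIn (adj T) (λ r → v ∈ X' r) s t
      X'-subtree v s t v∈X's v∈X't with ∈X'⁻ v∈X's | ∈X'⁻ v∈X't
      ... | u₁ , s∈path | u₂ , t∈path with prefix (path v u₁) s∈path | prefix (path v u₂) t∈path
      ... | p₁ , p₁⊆ | p₂ , p₂⊆ = toWalkIn (bridge (adj-sym T) p₁ p₂) λ r r∈ →
            [ ∈X'⁺ u₁ ∘ p₁⊆ r , ∈X'⁺ u₂ ∘ p₂⊆ r ]′ (∈-bridge⁻ (adj-sym T) p₁ p₂ r r∈)

  -- A neighbour t' of t keeping v is labelled by u if some route of v reaches t' after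
  -- passing t (that route ends at the edge bag of vu), and by zero if it is reached
  -- from the centre of v without passing t.  Acyclicity of T makes the labelling injective.
  module Labelling (t : Node T) (v : Fin n) where

    PassesFirst : Node T → Set
    PassesFirst t' = ∃ λ u → Before t t' (path v u)

    label : ∀ {t'} → Dec (PassesFirst t') → Fin (suc n)
    label (yes (u , _)) = suc u
    label (no  _)       = zero

    IsLabel : Fin (suc n) → Bool
    IsLabel zero    = true
    IsLabel (suc u) = ⌊ 1 ≤? μ G v u ⌋

    label-IsLabel : ∀ {t'} (passes? : Dec (PassesFirst t')) → IsLabel (label passes?) ≡ true
    label-IsLabel (no _) = refl
    label-IsLabel {t'} (yes (u , t<t')) =
      ⌊⌋≡true⁺ (1 ≤? μ G v u) (λ ¬vu → Route.trivial (route v u) ¬vu t t' t<t')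

    count-IsLabel≤ : ∀ {d} → MaxDegreeAtMost G d → count IsLabel ≤ suc d
    count-IsLabel≤ {d} maxdeg = s≤s (begin
        ΣF (λ u → χ ⌊ 1 ≤? μ G v u ⌋) ≤⟨ ΣF-mono (λ u → χ-≥1≤ (μ G v u)) ⟩
        ΣF (μ G v)                    ≤⟨ m≤m+n (ΣF (μ G v)) (μ G v v) ⟩
        deg (μ G) v                   ≤⟨ maxdeg v ⟩
        d                             ∎)
      where
        open ≤-Reasoning
        χ-≥1≤ : ∀ m → χ ⌊ 1 ≤? m ⌋ ≤ m
        χ-≥1≤ zero    = z≤n
        χ-≥1≤ (suc m) = s≤s z≤n

    approach-avoiding : ∀ {t'} → adj T t t' ≡ true → v ∈ X' t' → ¬ PassesFirst t'
      → Σ (Walk (centre v) t') (Avoids t)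
    approach-avoiding tt' v∈X't' ¬passes with ∈X'⁻ v∈X't'
    ... | u , t'∈path = prefix-avoiding (path v u) t'∈path (¬passes ∘ (u ,_)) (adj⇒≢ T tt')

    label-injective : ∀ {t₁ t₂} → adj T t t₁ ≡ true → v ∈ X' t₁ → adj T t t₂ ≡ true → v ∈ X' t₂
      → (passes₁? : Dec (PassesFirst t₁)) (passes₂? : Dec (PassesFirst t₂))
      → label passes₁? ≡ label passes₂? → t₁ ≡ t₂
    label-injective tt₁ _ tt₂ _ (yes (u , t<t₁)) (yes (.u , t<t₂)) refl =
      let (w , w-avoids) = after-avoiding (adj-sym T) (path v u) (Route.simple (route v u)) t<t₁ t<t₂
      in neighbours-joined-avoiding-≡ T tt₁ tt₂ w w-avoids
    label-injective tt₁ v∈₁ tt₂ v∈₂ (no ¬p₁) (no ¬p₂) refl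
      with approach-avoiding tt₁ v∈₁ ¬p₁ | approach-avoiding tt₂ v∈₂ ¬p₂
    ... | w₁ , w₁-avoids | w₂ , w₂-avoids =
      neighbours-joined-avoiding-≡ T tt₁ tt₂ (bridge (adj-sym T) w₁ w₂)
        λ x r → [ w₁-avoids x , w₂-avoids x ]′ (∈-bridge⁻ (adj-sym T) w₁ w₂ x r)
    label-injective _ _ _ _ (yes _) (no _)  ()
    label-injective _ _ _ _ (no _)  (yes _) ()

  neighboursContaining-X'≤ : ∀ {d} → MaxDegreeAtMost G d → ∀ t v → neighboursContaining T X' t v ≤ suc d
  neighboursContaining-X'≤ maxdeg t v =
    ≤-trans (count-≤-injection P IsLabel (λ t' _ → label (passes? t')) (λ t' _ → label-IsLabel (passes? t'))
                               injective)
            (count-IsLabel≤ maxdeg)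
    where
      open Labelling t v
      P : Node T → Bool
      P t' = adj T t t' ∧ (X' t' ∋ᵇ v)
      passes? : ∀ t' → Dec (PassesFirst t')
      passes? t' = any? (λ u → Before? t t' (path v u))
      injective : ∀ t₁ t₂ P₁ P₂ → label (passes? t₁) ≡ label (passes? t₂) → t₁ ≡ t₂
      injective t₁ t₂ P₁ P₂ =
        let (tt₁ , v∈₁) = ∧⁻ (adj T t t₁) P₁
            (tt₂ , v∈₂) = ∧⁻ (adj T t t₂) P₂ in
        label-injective tt₁ (∋ᵇ⇒∈ v∈₁) tt₂ (∋ᵇ⇒∈ v∈₂) (passes? t₁) (passes? t₂)

d+[1+d]*e≡[1+e]*d+[1+e]∸1 : ∀ d e → d + suc d * e ≡ suc e * d + suc e ∸ 1
d+[1+d]*e≡[1+e]*d+[1+e]∸1 d e = trans (semiring-identity d e) (cong (_∸ 1) (sym (+-suc (suc e * d) e)))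
  where
    semiring-identity : ∀ d e → d + suc d * e ≡ suc e * d + e
    semiring-identity = solve-∀

lemma5p1 : (d η : ℕ) → 1 ≤ d → 1 ≤ η
    → {n : ℕ} (G : Graph n) → MaxDegreeAtMost G d
    → (T : Tree) (X : Bags n T) → IsTreeDecomposition G T X
    → adhesion T X ≤ η
    → ∃ λ (X' : Bags n T) →
        IsTreeDecomposition G T X'
        × adhesion T X' ≤ adhesion T X
        × (∀ t → (X' t ⊆ X t) × IsSubgraph (torso G T X' t) (torso G T X t))
        × (∀ t v → v ∈ X' t → neighboursContaining T X' t v ≤ suc d)
        × (∀ t → SGMaxDegreeAtMost (torso G T X' t) (η * d + η ∸ 1))
lemma5p1 d (suc e) _ (s≤s z≤n) G maxdeg T X td adh≤η =
  X' , X'-decomposition , adhesion-mono T X'⊆X , (λ t → X'⊆X t , torso-mono T G X'⊆X t)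
  , (λ t v _ → neighboursContaining-X'≤ maxdeg t v) , torso-degree-bound
  where
    open Pruning td
    torso-degree-bound : ∀ t → SGMaxDegreeAtMost (torso G T X' t) (suc e * d + suc e ∸ 1)
    torso-degree-bound t v v∈X't = begin
      deg (mult (torso G T X' t)) v
        ≤⟨ torso-degree≤ T G X' t v∈X't ⟩
      deg (μ G) v + neighboursContaining T X' t v * (adhesion T X' ∸ 1)
        ≤⟨ +-mono-≤ (maxdeg v) (*-mono-≤ (neighboursContaining-X'≤ maxdeg t v)
                                         (∸-monoˡ-≤ 1 (≤-trans (adhesion-mono T X'⊆X) adh≤η))) ⟩
      d + suc d * e
        ≡⟨ d+[1+d]*e≡[1+e]*d+[1+e]∸1 d e ⟩
      suc e * d + suc e ∸ 1
        ∎
      where open ≤-Reasoning
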